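{- Let $n\in\mathbb{N}_0$ and let $P(x)=x\prod_{k=1}^{n}\left(x^2-\frac{(2k-1)^2}{4}\right)$. Then \[ \int_{\mathbb{Z}_p} P(x)\,d\mu_1(x)=-\frac12\,P'(0). \]
   Context: $p$ is an odd prime. For a polynomial $f:\mathbb{Z}_p\to\mathbb{C}_p$ the Volkenborn integral is $\int_{\mathbb{Z}_p} f(x)\,d\mu_1(x)=\lim_{N\to\infty}p^{ -N}\sum_{x=0}^{p^N-1}f(x)$. $P'$ denotes the derivative of $P$. -}

module Defs where

open import Data.Nat as ℕ using (ℕ; zero; suc; _≤_; _^_)
open import Data.Nat.Divisibility using (_∣_)
open import Data.Nat.Properties using (m^n≢0)
open import Data.Nat.Primality using (Prime; prime⇒nonZero)
open import Data.Integer as ℤ using (ℤ; +_)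
open import Data.Rational as ℚ using (ℚ; _/_; 0ℚ; 1ℚ; _+_; _*_; _-_; -_)
open import Data.List using (List; []; _∷_)
open import Data.Product using (Σ; _×_)
open import Relation.Nullary using (¬_)
open import Relation.Binary.PropositionalEquality using (_≡_)

-- Polynomials over ℚ as coefficient lists (constant term first)

Poly : Set
Poly = List ℚ

infixl 6 _+ₚ_
infixl 7 _*ₚ_ _·ₚ_

_+ₚ_ : Poly → Poly → Poly
[]      +ₚ q       = q
(a ∷ p) +ₚ []      = a ∷ p
(a ∷ p) +ₚ (b ∷ q) = (a + b) ∷ (p +ₚ q)

_·ₚ_ : ℚ → Poly → Poly
c ·ₚ []      = []
c ·ₚ (a ∷ p) = (c * a) ∷ (c ·ₚ p)

_*ₚ_ : Poly → Poly → Poly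
[]      *ₚ q = []
(a ∷ p) *ₚ q = (a ·ₚ q) +ₚ (0ℚ ∷ (p *ₚ q))

eval : Poly → ℚ → ℚ
eval []      x = 0ℚ
eval (a ∷ p) x = a + x * eval p x

derivFrom : ℕ → Poly → Poly
derivFrom i []      = []
derivFrom i (a ∷ p) = ((+ i / 1) * a) ∷ derivFrom (suc i) p

deriv : Poly → Poly
deriv []      = []
deriv (a ∷ p) = derivFrom 1 p

-- c k = (2k-1)²/4  (used for k ≥ 1)
cst : ℕ → ℚ
cst k = (+ ((2 ℕ.* k ℕ.∸ 1) ^ 2)) / 4

factor : ℕ → Poly
factor k = (- cst k) ∷ 0ℚ ∷ 1ℚ ∷ []

prodFactors : ℕ → Poly
prodFactors zero    = 1ℚ ∷ []
prodFactors (suc n) = prodFactors n *ₚ factor (suc n)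

Pn : ℕ → Poly
Pn n = (0ℚ ∷ 1ℚ ∷ []) *ₚ prodFactors n

-- v_p(q) ≥ k : q = p^k · c/d with p ∤ d  (true for q = 0)
ValAtLeast : ℕ → ℕ → ℚ → Set
ValAtLeast p k q =
  Σ ℤ λ c → Σ ℕ λ d → (¬ (p ∣ suc d)) × (q ≡ (c / suc d) * ((+ (p ^ k)) / 1))

PadicLimit : ℕ → (ℕ → ℚ) → ℚ → Set
PadicLimit p s L = ∀ k → Σ ℕ λ N₀ → ∀ N → N₀ ≤ N → ValAtLeast p k (s N - L)

sumBelow : ℕ → (ℕ → ℚ) → ℚ
sumBelow zero    f = 0ℚ
sumBelow (suc m) f = sumBelow m f + f m

riemann : (p : ℕ) → .{{ℕ.NonZero p}} → (ℕ → ℚ) → ℕ → ℚ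
riemann p f N = sumBelow (p ^ N) f * ((+ 1) / (p ^ N)) {{m^n≢0 p N}}

VolkenbornIntegralIs : (p : ℕ) → Prime p → (ℕ → ℚ) → ℚ → Set
VolkenbornIntegralIs p pp f L = PadicLimit p (riemann p {{prime⇒nonZero pp}} f) L

{-# OPTIONS --safe #-}
module Submission where

-- Scaling by 4ⁿ turns P into the odd integer polynomial G(x) = x ∏ₖ (4x² − (2k−1)²). For M = p^(N+1)
-- and S = Σ_{x<M} G(x), reflecting x ↦ M − x, oddness and the congruence G(y − M) ≡ G(y) − M G′(y)
-- (mod M²) give 2S + M G′(0) ≡ M Σ_{x<M} G′(x) (mod M²), and p^N divides Σ_{x<M} G′(x) because G′
-- preserves congruences. So the Riemann sum S/(4ⁿM) differs from −G′(0)/(2·4ⁿ) = −½P′(0) by p^N times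
-- a rational whose denominator 2·4ⁿ is prime to the odd prime p.

open import Defs

module OverIntegers where
  open import Data.Integer hiding (suc)
  open import Data.Integer.Properties using (+-comm; +-assoc; *-comm; *-identityʳ; +-identityˡ; +-identityʳ; pos-*)
  open import Data.Integer.Divisibility.Signed
  open import Data.Integer.Tactic.RingSolver using (solve-∀)
  open import Level using (0ℓ)
  import Relation.Binary.Reasoning.Setoid as SetoidReasoning
  open import Relation.Binary.Bundles using (Setoid)
  open import Relation.Binary.PropositionalEquality
  open import Data.Nat as ℕ using (ℕ; zero; suc)
  import Data.Nat.Properties as ℕ
  open import Data.Product using (Σ; _×_; _,_)

  infix 4 _≡_mod_

  record _≡_mod_ (a b m : ℤ) : Set where
    constructor congruent
    field
      modulus∣difference : m ∣ a - b

  ≡⇒≡-mod : ∀ {m a b} → a ≡ b → a ≡ b mod m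
  ≡⇒≡-mod {m} {a} refl = congruent (divides 0ℤ (lemma a m))
    where
    lemma : ∀ a m → a - a ≡ 0ℤ * m
    lemma = solve-∀

  mod-sym : ∀ {m a b} → a ≡ b mod m → b ≡ a mod m
  mod-sym {m} {a} {b} (congruent m∣a-b) = congruent (subst (m ∣_) (lemma a b) (∣m⇒∣-m m∣a-b))
    where
    lemma : ∀ a b → - (a - b) ≡ b - a
    lemma = solve-∀

  mod-trans : ∀ {m a b c} → a ≡ b mod m → b ≡ c mod m → a ≡ c mod m
  mod-trans {m} {a} {b} {c} (congruent m∣a-b) (congruent m∣b-c) =
    congruent (subst (m ∣_) (lemma a b c) (∣m∣n⇒∣m+n m∣a-b m∣b-c))
    where
    lemma : ∀ a b c → a - b + (b - c) ≡ a - c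
    lemma = solve-∀

  mod-setoid : ℤ → Setoid 0ℓ 0ℓ
  mod-setoid m = record
    { _≈_ = λ a b → a ≡ b mod m
    ; isEquivalence = record { refl = ≡⇒≡-mod refl ; sym = mod-sym ; trans = mod-trans }
    }

  module ≡-mod-Reasoning (m : ℤ) = SetoidReasoning (mod-setoid m)

  mod-+ : ∀ {m a b c d} → a ≡ b mod m → c ≡ d mod m → a + c ≡ b + d mod m
  mod-+ {m} {a} {b} {c} {d} (congruent m∣a-b) (congruent m∣c-d) =
    congruent (subst (m ∣_) (lemma a b c d) (∣m∣n⇒∣m+n m∣a-b m∣c-d))
    where
    lemma : ∀ a b c d → a - b + (c - d) ≡ a + c - (b + d)
    lemma = solve-∀

  mod-+ˡ : ∀ {m a b} c → a ≡ b mod m → c + a ≡ c + b mod m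
  mod-+ˡ c = mod-+ (≡⇒≡-mod {a = c} refl)

  mod-* : ∀ {m a b c d} → a ≡ b mod m → c ≡ d mod m → a * c ≡ b * d mod m
  mod-* {m} {a} {b} {c} {d} (congruent m∣a-b) (congruent m∣c-d) =
    congruent (subst (m ∣_) (lemma a b c d)
                     (∣m∣n⇒∣m+n (∣m⇒∣m*n c m∣a-b) (∣n⇒∣m*n b m∣c-d)))
    where
    lemma : ∀ a b c d → (a - b) * c + b * (c - d) ≡ a * c - b * d
    lemma = solve-∀

  mod-*ˡ : ∀ {m a b} c → a ≡ b mod m → c * a ≡ c * b mod m
  mod-*ˡ c = mod-* (≡⇒≡-mod {a = c} refl)

  mod-∣ : ∀ {m n a b} → m ∣ n → a ≡ b mod n → a ≡ b mod m
  mod-∣ m∣n (congruent n∣a-b) = congruent (∣-trans m∣n n∣a-b)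

  +-multiple≡-mod : ∀ {m} a k → a + k * m ≡ a mod m
  +-multiple≡-mod {m} a k = congruent (divides k (lemma a k m))
    where
    lemma : ∀ a k m → a + k * m - a ≡ k * m
    lemma = solve-∀

  +-multipleʳ≡-mod : ∀ {m} a k → a + m * k ≡ a mod m
  +-multipleʳ≡-mod {m} a k rewrite *-comm m k = +-multiple≡-mod a k

  mod-square-quotient : ∀ {a b m} → a ≡ m * b mod m * m → Σ ℤ λ K → a ≡ K * m × (K ≡ b mod m)
  mod-square-quotient {a} {b} {m} (congruent (divides e eq)) = b + e * m , sum≡ , +-multiple≡-mod b e
    where
    sum≡ : a ≡ (b + e * m) * m
    sum≡ = begin
      a                      ≡⟨ lemma₁ a (m * b) ⟩
      a - m * b + m * b      ≡⟨ cong (_+ m * b) eq ⟩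
      e * (m * m) + m * b    ≡⟨ lemma₂ e m b ⟩
      (b + e * m) * m        ∎
      where
      open ≡-Reasoning
      lemma₁ : ∀ a c → a ≡ a - c + c
      lemma₁ = solve-∀
      lemma₂ : ∀ e m b → e * (m * m) + m * b ≡ (b + e * m) * m
      lemma₂ = solve-∀

  ∣-cong-mod : ∀ {m a b} → a ≡ b mod m → m ∣ b → m ∣ a
  ∣-cong-mod {m} {a} {b} (congruent m∣a-b) m∣b = subst (m ∣_) (lemma a b) (∣m∣n⇒∣m+n m∣a-b m∣b)
    where
    lemma : ∀ a b → a - b + b ≡ a
    lemma = solve-∀

  sumBelowℤ : ℕ → (ℤ → ℤ) → ℤ
  sumBelowℤ zero    f = 0ℤ
  sumBelowℤ (suc m) f = sumBelowℤ m f + f (+ m)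

  sumBelowℤ-cong : ∀ m {f g} → (∀ x → f x ≡ g x) → sumBelowℤ m f ≡ sumBelowℤ m g
  sumBelowℤ-cong zero    f≗g = refl
  sumBelowℤ-cong (suc m) f≗g = cong₂ _+_ (sumBelowℤ-cong m f≗g) (f≗g (+ m))

  sumBelowℤ-cong-mod : ∀ m {d f g} → (∀ x → f x ≡ g x mod d) → sumBelowℤ m f ≡ sumBelowℤ m g mod d
  sumBelowℤ-cong-mod zero    f≈g = ≡⇒≡-mod refl
  sumBelowℤ-cong-mod (suc m) f≈g = mod-+ (sumBelowℤ-cong-mod m f≈g) (f≈g (+ m))

  sumBelowℤ-++ : ∀ m n f → sumBelowℤ (m ℕ.+ n) f ≡ sumBelowℤ m f + sumBelowℤ n (λ y → f (y + + m))
  sumBelowℤ-++ m zero    f rewrite ℕ.+-identityʳ m = sym (+-identityʳ (sumBelowℤ m f))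
  sumBelowℤ-++ m (suc n) f rewrite ℕ.+-suc m n = begin
    sumBelowℤ (m ℕ.+ n) f + f (+ (m ℕ.+ n))
      ≡⟨ cong₂ _+_ (sumBelowℤ-++ m n f) (cong (λ k → f (+ k)) (ℕ.+-comm m n)) ⟩
    sumBelowℤ m f + sumBelowℤ n (λ y → f (y + + m)) + f (+ n + + m)
      ≡⟨ +-assoc (sumBelowℤ m f) _ _ ⟩
    sumBelowℤ m f + (sumBelowℤ n (λ y → f (y + + m)) + f (+ n + + m)) ∎
    where open ≡-Reasoning

  sumBelowℤ-reverse : ∀ m f → sumBelowℤ m f ≡ sumBelowℤ m (λ y → f (+ m - 1ℤ - y))
  sumBelowℤ-reverse zero    f = refl
  sumBelowℤ-reverse (suc m) f = begin
    sumBelowℤ m f + f (+ m)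
      ≡⟨ cong₂ _+_ (sumBelowℤ-reverse m f) (cong f (last (+ m))) ⟩
    sumBelowℤ m (λ y → f (+ m - 1ℤ - y)) + g 0ℤ
      ≡⟨ +-comm (sumBelowℤ m (λ y → f (+ m - 1ℤ - y))) (g 0ℤ) ⟩
    g 0ℤ + sumBelowℤ m (λ y → f (+ m - 1ℤ - y))
      ≡⟨ cong₂ _+_ (sym (+-identityˡ (g 0ℤ))) (sumBelowℤ-cong m (λ y → cong f (shift (+ m) y))) ⟩
    0ℤ + g 0ℤ + sumBelowℤ m (λ y → g (y + 1ℤ))
      ≡⟨ sumBelowℤ-++ 1 m g ⟨
    sumBelowℤ (suc m) g ∎
    where
    open ≡-Reasoning
    last : ∀ x → x ≡ 1ℤ + x - 1ℤ - 0ℤ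
    last = solve-∀
    shift : ∀ x y → x - 1ℤ - y ≡ 1ℤ + x - 1ℤ - (y + 1ℤ)
    shift = solve-∀
    g : ℤ → ℤ
    g y = f (+ suc m - 1ℤ - y)

  sumBelowℤ-linear : ∀ m a b f g →
    sumBelowℤ m (λ y → a * f y + b * g y) ≡ a * sumBelowℤ m f + b * sumBelowℤ m g
  sumBelowℤ-linear zero    a b f g = sym (lemma a b)
    where
    lemma : ∀ a b → a * 0ℤ + b * 0ℤ ≡ 0ℤ
    lemma = solve-∀
  sumBelowℤ-linear (suc m) a b f g = begin
    sumBelowℤ m (λ y → a * f y + b * g y) + (a * f (+ m) + b * g (+ m))
      ≡⟨ cong (_+ (a * f (+ m) + b * g (+ m))) (sumBelowℤ-linear m a b f g) ⟩
    a * sumBelowℤ m f + b * sumBelowℤ m g + (a * f (+ m) + b * g (+ m))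
      ≡⟨ lemma a b (sumBelowℤ m f) (sumBelowℤ m g) (f (+ m)) (g (+ m)) ⟩
    a * (sumBelowℤ m f + f (+ m)) + b * (sumBelowℤ m g + g (+ m)) ∎
    where
    open ≡-Reasoning
    lemma : ∀ a b F G x y → a * F + b * G + (a * x + b * y) ≡ a * (F + x) + b * (G + y)
    lemma = solve-∀

  record PreservesCongruence (f : ℤ → ℤ) : Set where
    constructor preservesCongruence
    field
      congruence : ∀ a t → f (a + t) ≡ f a mod t

  open PreservesCongruence public

  record HasDerivative (f f′ : ℤ → ℤ) : Set where
    constructor hasDerivative
    field
      taylor : ∀ a t → f (a + t) ≡ f a + t * f′ a mod t * t

  open HasDerivative public

  Odd : (ℤ → ℤ) → Set
  Odd f = ∀ x → f (- x) ≡ - f x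

  preservesCongruence-+ : ∀ {f g} → PreservesCongruence f → PreservesCongruence g →
                          PreservesCongruence (λ x → f x + g x)
  preservesCongruence-+ pf pg =
    preservesCongruence λ a t → mod-+ (congruence pf a t) (congruence pg a t)

  preservesCongruence-* : ∀ {f g} → PreservesCongruence f → PreservesCongruence g →
                          PreservesCongruence (λ x → f x * g x)
  preservesCongruence-* pf pg =
    preservesCongruence λ a t → mod-* (congruence pf a t) (congruence pg a t)

  preservesCongruence-shift : ∀ {f} s → PreservesCongruence f → PreservesCongruence (λ y → f (y + s))
  preservesCongruence-shift {f} s pf = preservesCongruence λ a t →
    subst (λ u → f u ≡ f (a + s) mod t) (lemma a s t) (congruence pf (a + s) t)
    where
    lemma : ∀ a s t → a + s + t ≡ a + t + s
    lemma = solve-∀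

  hasDerivative⇒preservesCongruence : ∀ {f f′} → HasDerivative f f′ → PreservesCongruence f
  hasDerivative⇒preservesCongruence {f} {f′} df = preservesCongruence λ a t →
    mod-trans (mod-∣ (divides t refl) (taylor df a t)) (+-multipleʳ≡-mod (f a) (f′ a))

  hasDerivative-const : ∀ c → HasDerivative (λ _ → c) (λ _ → 0ℤ)
  hasDerivative-const c = hasDerivative λ a t → ≡⇒≡-mod (lemma c t)
    where
    lemma : ∀ c t → c ≡ c + t * 0ℤ
    lemma = solve-∀

  hasDerivative-id : HasDerivative (λ x → x) (λ _ → 1ℤ)
  hasDerivative-id = hasDerivative λ a t → ≡⇒≡-mod (lemma a t)
    where
    lemma : ∀ a t → a + t ≡ a + t * 1ℤ
    lemma = solve-∀

  hasDerivative-* : ∀ {f f′ g g′} → HasDerivative f f′ → HasDerivative g g′ →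
                    HasDerivative (λ x → f x * g x) (λ x → f′ x * g x + f x * g′ x)
  hasDerivative-* {f} {f′} {g} {g′} df dg = hasDerivative λ a t →
    let open ≡-mod-Reasoning (t * t) in begin
    f (a + t) * g (a + t)                            ≈⟨ mod-* (taylor df a t) (taylor dg a t) ⟩
    (f a + t * f′ a) * (g a + t * g′ a)              ≡⟨ expand (f a) (f′ a) (g a) (g′ a) t ⟩
    f a * g a + t * (f′ a * g a + f a * g′ a) + f′ a * g′ a * (t * t)
                                                     ≈⟨ +-multiple≡-mod _ (f′ a * g′ a) ⟩
    f a * g a + t * (f′ a * g a + f a * g′ a)        ∎
    where
    expand : ∀ F F′ G G′ t →
      (F + t * F′) * (G + t * G′) ≡ F * G + t * (F′ * G + F * G′) + F′ * G′ * (t * t)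
    expand = solve-∀

  sumBelowℤ-periodic : ∀ m q {f} → PreservesCongruence f →
                       sumBelowℤ (q ℕ.* m) f ≡ + q * sumBelowℤ m f mod + m
  sumBelowℤ-periodic m zero    pf = ≡⇒≡-mod refl
  sumBelowℤ-periodic m (suc q) {f} pf = begin
    sumBelowℤ (m ℕ.+ q ℕ.* m) f                          ≡⟨ sumBelowℤ-++ m (q ℕ.* m) f ⟩
    sumBelowℤ m f + sumBelowℤ (q ℕ.* m) (λ y → f (y + + m))
      ≈⟨ mod-+ˡ (sumBelowℤ m f) (sumBelowℤ-periodic m q (preservesCongruence-shift (+ m) pf)) ⟩
    sumBelowℤ m f + + q * sumBelowℤ m (λ y → f (y + + m))
      ≈⟨ mod-+ˡ (sumBelowℤ m f) (mod-*ˡ (+ q) (sumBelowℤ-cong-mod m (λ y → congruence pf y (+ m)))) ⟩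
    sumBelowℤ m f + + q * sumBelowℤ m f                  ≡⟨ lemma (sumBelowℤ m f) (+ q) ⟩
    (1ℤ + + q) * sumBelowℤ m f                           ∎
    where
    open ≡-mod-Reasoning (+ m)
    lemma : ∀ s q → s + q * s ≡ (1ℤ + q) * s
    lemma = solve-∀

  ^-∣-sumBelowℤ-^ : ∀ p {f} → PreservesCongruence f → ∀ N →
                    + (p ℕ.^ N) ∣ sumBelowℤ (p ℕ.^ suc N) f
  ^-∣-sumBelowℤ-^ p {f} pf zero    = divides (sumBelowℤ (p ℕ.* 1) f) (sym (*-identityʳ _))
  ^-∣-sumBelowℤ-^ p {f} pf (suc N) =
    ∣-cong-mod (sumBelowℤ-periodic (p ℕ.^ suc N) p pf)
               (subst (_∣ + p * sumBelowℤ (p ℕ.^ suc N) f) (sym (pos-* p (p ℕ.^ N)))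
                      (*-monoʳ-∣ (+ p) (^-∣-sumBelowℤ-^ p pf N)))

  odd-reflect : ∀ {g g′} → Odd g → HasDerivative g g′ → ∀ m y →
                g (m - y) ≡ -1ℤ * g y + m * g′ y mod m * m
  odd-reflect {g} {g′} og dg m y = begin
    g (m - y)                       ≡⟨ cong g (reflect m y) ⟩
    g (- (y + - m))                 ≡⟨ og (y + - m) ⟩
    - g (y + - m)                   ≡⟨ neg≡-1* (g (y + - m)) ⟩
    -1ℤ * g (y + - m)               ≈⟨ mod-*ˡ -1ℤ taylor-at-−m ⟩
    -1ℤ * (g y + - m * g′ y)        ≡⟨ distribute (g y) (g′ y) m ⟩
    -1ℤ * g y + m * g′ y            ∎
    where
    open ≡-mod-Reasoning (m * m)
    reflect : ∀ m y → m - y ≡ - (y + - m)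
    reflect = solve-∀
    neg≡-1* : ∀ x → - x ≡ -1ℤ * x
    neg≡-1* = solve-∀
    neg*neg : ∀ m → - m * - m ≡ m * m
    neg*neg = solve-∀
    distribute : ∀ a b m → -1ℤ * (a + - m * b) ≡ -1ℤ * a + m * b
    distribute = solve-∀
    taylor-at-−m : g (y + - m) ≡ g y + - m * g′ y mod m * m
    taylor-at-−m = subst (g (y + - m) ≡ g y + - m * g′ y mod_) (neg*neg m) (taylor dg y (- m))

  sumBelowℤ-odd-shift : ∀ {g g′} → Odd g → HasDerivative g g′ → ∀ m →
    sumBelowℤ m (λ y → g (y + 1ℤ)) ≡ -1ℤ * sumBelowℤ m g + + m * sumBelowℤ m g′ mod + m * + m
  sumBelowℤ-odd-shift {g} {g′} og dg m = begin
    sumBelowℤ m (λ y → g (y + 1ℤ))                  ≡⟨ sumBelowℤ-reverse m (λ y → g (y + 1ℤ)) ⟩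
    sumBelowℤ m (λ y → g (+ m - 1ℤ - y + 1ℤ))       ≡⟨ sumBelowℤ-cong m (λ y → cong g (cancel (+ m) y)) ⟩
    sumBelowℤ m (λ y → g (+ m - y))                 ≈⟨ sumBelowℤ-cong-mod m (odd-reflect og dg (+ m)) ⟩
    sumBelowℤ m (λ y → -1ℤ * g y + + m * g′ y)      ≡⟨ sumBelowℤ-linear m -1ℤ (+ m) g g′ ⟩
    -1ℤ * sumBelowℤ m g + + m * sumBelowℤ m g′      ∎
    where
    open ≡-mod-Reasoning (+ m * + m)
    cancel : ∀ m y → m - 1ℤ - y + 1ℤ ≡ m - y
    cancel = solve-∀

  sumBelowℤ-odd : ∀ {g g′} → Odd g → HasDerivative g g′ → ∀ m →
    sumBelowℤ m g + sumBelowℤ m g + + m * g′ 0ℤ ≡ + m * sumBelowℤ m g′ mod + m * + m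
  sumBelowℤ-odd {g} {g′} og dg m = begin
    S + S + M * g′ 0ℤ              ≡⟨ regroup S (g 0ℤ) (M * g′ 0ℤ) ⟩
    S + S - g 0ℤ + (g 0ℤ + M * g′ 0ℤ)
      ≈⟨ mod-+ˡ (S + S - g 0ℤ) (mod-sym (taylor dg 0ℤ M)) ⟩
    S + S - g 0ℤ + g (0ℤ + M)      ≡⟨ cong (λ x → S + S - g 0ℤ + g x) (+-identityˡ M) ⟩
    S + S - g 0ℤ + g M             ≡⟨ telescope S (g 0ℤ) (g M) T ends ⟩
    S + T                          ≈⟨ mod-+ˡ S (sumBelowℤ-odd-shift og dg m) ⟩
    S + (-1ℤ * S + M * Σ′)         ≡⟨ cancel S (M * Σ′) ⟩
    M * Σ′                         ∎
    where
    open ≡-mod-Reasoning (+ m * + m)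
    M = + m
    S = sumBelowℤ m g
    T = sumBelowℤ m (λ y → g (y + 1ℤ))
    Σ′ = sumBelowℤ m g′
    ends : S + g M ≡ 0ℤ + g 0ℤ + T
    ends = sumBelowℤ-++ 1 m g
    regroup : ∀ S a b → S + S + b ≡ S + S - a + (a + b)
    regroup = solve-∀
    telescope : ∀ S a b T → S + b ≡ 0ℤ + a + T → S + S - a + b ≡ S + T
    telescope S a b T e = trans (assoc S a b) (trans (cong (λ x → S + x - a) e) (unshift S a T))
      where
      assoc : ∀ S a b → S + S - a + b ≡ S + (S + b) - a
      assoc = solve-∀
      unshift : ∀ S a T → S + (0ℤ + a + T) - a ≡ S + T
      unshift = solve-∀
    cancel : ∀ S x → S + (-1ℤ * S + x) ≡ x
    cancel = solve-∀

  sumBelowℤ-odd-^ : ∀ {g g′} → Odd g → HasDerivative g g′ → PreservesCongruence g′ → ∀ p N →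
    let M = p ℕ.^ suc N in
    Σ ℤ λ K → sumBelowℤ M g + sumBelowℤ M g + + M * g′ 0ℤ ≡ K * + M × + (p ℕ.^ N) ∣ K
  sumBelowℤ-odd-^ og dg pg′ p N =
    let K , sum≡ , K≡Σ′ = mod-square-quotient (sumBelowℤ-odd og dg (p ℕ.^ suc N))
    in K , sum≡ , ∣-cong-mod (mod-∣ (divides (+ p) (pos-* p (p ℕ.^ N))) K≡Σ′) (^-∣-sumBelowℤ-^ p pg′ N)

  -- cstℤ, factorℤ, prodFactorsℤ and Pnℤ are 4, 4, 4ⁿ and 4ⁿ times cst, factor, prodFactors and Pn.
  cstℤ : ℕ → ℤ
  cstℤ k = + ((2 ℕ.* k ℕ.∸ 1) ℕ.^ 2)

  factorℤ : ℕ → ℤ → ℤ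
  factorℤ k x = + 4 * (x * x) - cstℤ k

  factorℤ′ : ℤ → ℤ
  factorℤ′ x = + 8 * x

  prodFactorsℤ : ℕ → ℤ → ℤ
  prodFactorsℤ zero    x = 1ℤ
  prodFactorsℤ (suc n) x = prodFactorsℤ n x * factorℤ (suc n) x

  prodFactorsℤ′ : ℕ → ℤ → ℤ
  prodFactorsℤ′ zero    x = 0ℤ
  prodFactorsℤ′ (suc n) x = prodFactorsℤ′ n x * factorℤ (suc n) x + prodFactorsℤ n x * factorℤ′ x

  Pnℤ : ℕ → ℤ → ℤ
  Pnℤ n x = x * prodFactorsℤ n x

  Pnℤ′ : ℕ → ℤ → ℤ
  Pnℤ′ n x = 1ℤ * prodFactorsℤ n x + x * prodFactorsℤ′ n x

  hasDerivative-factorℤ : ∀ k → HasDerivative (factorℤ k) factorℤ′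
  hasDerivative-factorℤ k = hasDerivative λ a t →
    let open ≡-mod-Reasoning (t * t) in begin
    factorℤ k (a + t)                            ≡⟨ expand a t (cstℤ k) ⟩
    factorℤ k a + t * factorℤ′ a + + 4 * (t * t) ≈⟨ +-multiple≡-mod _ (+ 4) ⟩
    factorℤ k a + t * factorℤ′ a                 ∎
    where
    expand : ∀ a t c →
      + 4 * ((a + t) * (a + t)) - c ≡ + 4 * (a * a) - c + t * (+ 8 * a) + + 4 * (t * t)
    expand = solve-∀

  preservesCongruence-factorℤ′ : PreservesCongruence factorℤ′
  preservesCongruence-factorℤ′ = preservesCongruence-* {λ _ → + 8} {λ x → x}
    (hasDerivative⇒preservesCongruence (hasDerivative-const (+ 8)))
    (hasDerivative⇒preservesCongruence hasDerivative-id)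

  hasDerivative-prodFactorsℤ : ∀ n → HasDerivative (prodFactorsℤ n) (prodFactorsℤ′ n)
  hasDerivative-prodFactorsℤ zero    = hasDerivative-const 1ℤ
  hasDerivative-prodFactorsℤ (suc n) =
    hasDerivative-* (hasDerivative-prodFactorsℤ n) (hasDerivative-factorℤ (suc n))

  preservesCongruence-prodFactorsℤ′ : ∀ n → PreservesCongruence (prodFactorsℤ′ n)
  preservesCongruence-prodFactorsℤ′ zero    = hasDerivative⇒preservesCongruence (hasDerivative-const 0ℤ)
  preservesCongruence-prodFactorsℤ′ (suc n) = preservesCongruence-+
    (preservesCongruence-* (preservesCongruence-prodFactorsℤ′ n)
      (hasDerivative⇒preservesCongruence (hasDerivative-factorℤ (suc n))))
    (preservesCongruence-* (hasDerivative⇒preservesCongruence (hasDerivative-prodFactorsℤ n))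
      preservesCongruence-factorℤ′)

  hasDerivative-Pnℤ : ∀ n → HasDerivative (Pnℤ n) (Pnℤ′ n)
  hasDerivative-Pnℤ n = hasDerivative-* hasDerivative-id (hasDerivative-prodFactorsℤ n)

  preservesCongruence-Pnℤ′ : ∀ n → PreservesCongruence (Pnℤ′ n)
  preservesCongruence-Pnℤ′ n = preservesCongruence-+
    (preservesCongruence-* (hasDerivative⇒preservesCongruence (hasDerivative-const 1ℤ))
      (hasDerivative⇒preservesCongruence (hasDerivative-prodFactorsℤ n)))
    (preservesCongruence-* (hasDerivative⇒preservesCongruence hasDerivative-id)
      (preservesCongruence-prodFactorsℤ′ n))

  prodFactorsℤ-even : ∀ n x → prodFactorsℤ n (- x) ≡ prodFactorsℤ n x
  prodFactorsℤ-even zero    x = refl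
  prodFactorsℤ-even (suc n) x =
    cong₂ _*_ (prodFactorsℤ-even n x) (cong (λ y → + 4 * y - cstℤ (suc n)) (neg*neg x))
    where
    neg*neg : ∀ x → - x * - x ≡ x * x
    neg*neg = solve-∀

  Pnℤ-odd : ∀ n → Odd (Pnℤ n)
  Pnℤ-odd n x = trans (cong (- x *_) (prodFactorsℤ-even n x)) (neg-* x (prodFactorsℤ n x))
    where
    neg-* : ∀ x y → - x * y ≡ - (x * y)
    neg-* = solve-∀

module OverRationals where
  open OverIntegers using (cstℤ; factorℤ; prodFactorsℤ; prodFactorsℤ′; Pnℤ; Pnℤ′; sumBelowℤ)
  open import Data.Integer as ℤ using (ℤ; +_; 0ℤ; 1ℤ)
  import Data.Integer.Tactic.RingSolver as ℤ
  open import Data.Nat as ℕ using (ℕ; zero; suc)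
  import Data.Nat.Properties as ℕ
  open import Data.Rational
  open import Data.Rational.Properties
    using (+-*-commutativeRing; toℚᵘ-injective; toℚᵘ-fromℚᵘ; fromℚᵘ-cong;
           toℚᵘ-homo-+; toℚᵘ-homo-*; toℚᵘ-homo‿-; +-identityˡ; +-identityʳ; *-zeroˡ; *-zeroʳ;
           *-identityʳ; *-assoc; *-comm; *-distribʳ-+)
  import Data.Rational.Unnormalised as ℚᵘ
  import Data.Rational.Unnormalised.Properties as ℚᵘ
  open import Data.List using ([]; _∷_)
  open import Data.Integer.Divisibility.Signed using (_∣_; divides)
  import Data.Nat.Divisibility as ℕ
  open import Data.Nat.Primality using (Prime; prime⇒nonTrivial; euclidsLemma)
  open import Data.Product using (_,_)
  open import Data.Sum using (inj₁; inj₂; [_,_]′)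
  open import Relation.Nullary using (¬_)
  open import Level using (0ℓ)
  open import Relation.Nullary.Decidable using (dec⇒maybe)
  open import Relation.Binary.PropositionalEquality
  open import Tactic.RingSolver using (solve-∀)
  open import Tactic.RingSolver.Core.AlmostCommutativeRing using (AlmostCommutativeRing; fromCommutativeRing)
  open ≡-Reasoning

  ℚ-ring : AlmostCommutativeRing 0ℓ 0ℓ
  ℚ-ring = fromCommutativeRing +-*-commutativeRing (λ x → dec⇒maybe (0ℚ ≟ x))

  fromℚᵘ-homo-+ : ∀ p q → fromℚᵘ (p ℚᵘ.+ q) ≡ fromℚᵘ p + fromℚᵘ q
  fromℚᵘ-homo-+ p q = toℚᵘ-injective (ℚᵘ.≃-trans (toℚᵘ-fromℚᵘ (p ℚᵘ.+ q))
    (ℚᵘ.≃-sym (ℚᵘ.≃-trans (toℚᵘ-homo-+ (fromℚᵘ p) (fromℚᵘ q))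
                          (ℚᵘ.+-cong (toℚᵘ-fromℚᵘ p) (toℚᵘ-fromℚᵘ q)))))

  fromℚᵘ-homo-* : ∀ p q → fromℚᵘ (p ℚᵘ.* q) ≡ fromℚᵘ p * fromℚᵘ q
  fromℚᵘ-homo-* p q = toℚᵘ-injective (ℚᵘ.≃-trans (toℚᵘ-fromℚᵘ (p ℚᵘ.* q))
    (ℚᵘ.≃-sym (ℚᵘ.≃-trans (toℚᵘ-homo-* (fromℚᵘ p) (fromℚᵘ q))
                          (ℚᵘ.*-cong (toℚᵘ-fromℚᵘ p) (toℚᵘ-fromℚᵘ q)))))

  fromℚᵘ-homo‿- : ∀ p → fromℚᵘ (ℚᵘ.- p) ≡ - fromℚᵘ p
  fromℚᵘ-homo‿- p = toℚᵘ-injective (ℚᵘ.≃-trans (toℚᵘ-fromℚᵘ (ℚᵘ.- p))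
    (ℚᵘ.≃-sym (ℚᵘ.≃-trans (toℚᵘ-homo‿- (fromℚᵘ p)) (ℚᵘ.-‿cong (toℚᵘ-fromℚᵘ p)))))

  ι : ℤ → ℚ
  ι a = a / 1

  ι-+ : ∀ a b → ι (a ℤ.+ b) ≡ ι a + ι b
  ι-+ a b = trans (fromℚᵘ-cong {ℚᵘ.mkℚᵘ (a ℤ.+ b) 0} {ℚᵘ.mkℚᵘ a 0 ℚᵘ.+ ℚᵘ.mkℚᵘ b 0} (ℚᵘ.*≡* (lemma a b)))
                  (fromℚᵘ-homo-+ (ℚᵘ.mkℚᵘ a 0) (ℚᵘ.mkℚᵘ b 0))
    where
    lemma : ∀ a b → (a ℤ.+ b) ℤ.* + 1 ≡ (a ℤ.* + 1 ℤ.+ b ℤ.* + 1) ℤ.* + 1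
    lemma = ℤ.solve-∀

  ι-* : ∀ a b → ι (a ℤ.* b) ≡ ι a * ι b
  ι-* a b = fromℚᵘ-homo-* (ℚᵘ.mkℚᵘ a 0) (ℚᵘ.mkℚᵘ b 0)

  ι-neg : ∀ a → ι (ℤ.- a) ≡ - ι a
  ι-neg a = fromℚᵘ-homo‿- (ℚᵘ.mkℚᵘ a 0)

  /-as-ι* : ∀ a k → a / suc k ≡ ι a * (+ 1 / suc k)
  /-as-ι* a k = trans (fromℚᵘ-cong {ℚᵘ.mkℚᵘ a k} {ℚᵘ.mkℚᵘ a 0 ℚᵘ.* ℚᵘ.mkℚᵘ (+ 1) k}
                        (ℚᵘ.*≡* (trans (cong (λ n → a ℤ.* + suc n) (ℕ.+-identityʳ k)) (lemma a (+ suc k)))))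
                      (fromℚᵘ-homo-* (ℚᵘ.mkℚᵘ a 0) (ℚᵘ.mkℚᵘ (+ 1) k))
    where
    lemma : ∀ a d → a ℤ.* d ≡ (a ℤ.* + 1) ℤ.* d
    lemma = ℤ.solve-∀

  1/-* : ∀ a b → + 1 / (suc a ℕ.* suc b) ≡ (+ 1 / suc a) * (+ 1 / suc b)
  1/-* a b = trans (fromℚᵘ-cong {ℚᵘ.mkℚᵘ (+ 1) (b ℕ.+ a ℕ.* suc b)} {ℚᵘ.mkℚᵘ (+ 1) a ℚᵘ.* ℚᵘ.mkℚᵘ (+ 1) b}
                     (ℚᵘ.*≡* (lemma (+ (suc a ℕ.* suc b)))))
                   (fromℚᵘ-homo-* (ℚᵘ.mkℚᵘ (+ 1) a) (ℚᵘ.mkℚᵘ (+ 1) b))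
    where
    lemma : ∀ d → + 1 ℤ.* d ≡ (+ 1 ℤ.* + 1) ℤ.* d
    lemma = ℤ.solve-∀

  ι-*-1/ : ∀ m .{{_ : ℕ.NonZero m}} → ι (+ m) * (+ 1 / m) ≡ 1ℚ
  ι-*-1/ (suc k) = trans (sym (/-as-ι* (+ suc k) k))
                         (fromℚᵘ-cong {ℚᵘ.mkℚᵘ (+ suc k) k} {ℚᵘ.mkℚᵘ (+ 1) 0} (ℚᵘ.*≡* (lemma (+ suc k))))
    where
    lemma : ∀ d → d ℤ.* + 1 ≡ + 1 ℤ.* d
    lemma = ℤ.solve-∀

  eval-+ₚ : ∀ p q x → eval (p +ₚ q) x ≡ eval p x + eval q x
  eval-+ₚ []      q       x = sym (+-identityˡ (eval q x))
  eval-+ₚ (a ∷ p) []      x = sym (+-identityʳ (a + x * eval p x))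
  eval-+ₚ (a ∷ p) (b ∷ q) x =
    trans (cong (λ z → a + b + x * z) (eval-+ₚ p q x)) (lemma a b x (eval p x) (eval q x))
    where
    lemma : ∀ a b x P Q → a + b + x * (P + Q) ≡ a + x * P + (b + x * Q)
    lemma = solve-∀ ℚ-ring

  eval-·ₚ : ∀ c p x → eval (c ·ₚ p) x ≡ c * eval p x
  eval-·ₚ c []      x = sym (*-zeroʳ c)
  eval-·ₚ c (a ∷ p) x = trans (cong (λ z → c * a + x * z) (eval-·ₚ c p x)) (lemma c a x (eval p x))
    where
    lemma : ∀ c a x P → c * a + x * (c * P) ≡ c * (a + x * P)
    lemma = solve-∀ ℚ-ring

  eval-*ₚ : ∀ p q x → eval (p *ₚ q) x ≡ eval p x * eval q x
  eval-*ₚ []      q x = sym (*-zeroˡ (eval q x))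
  eval-*ₚ (a ∷ p) q x = begin
    eval ((a ·ₚ q) +ₚ (0ℚ ∷ (p *ₚ q))) x             ≡⟨ eval-+ₚ (a ·ₚ q) (0ℚ ∷ (p *ₚ q)) x ⟩
    eval (a ·ₚ q) x + (0ℚ + x * eval (p *ₚ q) x)
      ≡⟨ cong₂ (λ u v → u + (0ℚ + x * v)) (eval-·ₚ a q x) (eval-*ₚ p q x) ⟩
    a * eval q x + (0ℚ + x * (eval p x * eval q x))  ≡⟨ lemma a x (eval p x) (eval q x) ⟩
    (a + x * eval p x) * eval q x                    ∎
    where
    lemma : ∀ a x P Q → a * Q + (0ℚ + x * (P * Q)) ≡ (a + x * P) * Q
    lemma = solve-∀ ℚ-ring

  eval-deriv-x*ₚ-0 : ∀ q → eval (deriv ((0ℚ ∷ 1ℚ ∷ []) *ₚ q)) 0ℚ ≡ eval q 0ℚ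
  eval-deriv-x*ₚ-0 []           = refl
  eval-deriv-x*ₚ-0 (a ∷ [])     = lemma a
    where
    lemma : ∀ a → + 1 / 1 * (1ℚ * a + 0ℚ) + 0ℚ * (+ 2 / 1 * (1ℚ * 0ℚ + 0ℚ) + 0ℚ * 0ℚ) ≡ a + 0ℚ * 0ℚ
    lemma = solve-∀ ℚ-ring
  -- The tails are spelled out because ℚ's _+_ and _*_ are not injective, so unification cannot recover them.
  eval-deriv-x*ₚ-0 (a ∷ b ∷ q) =
    lemma a b (eval (derivFrom 2 ((0ℚ ·ₚ q) +ₚ ((1ℚ ·ₚ (b ∷ q)) +ₚ ([] *ₚ (a ∷ b ∷ q))))) 0ℚ) (eval (b ∷ q) 0ℚ)
    where
    lemma : ∀ a b z w → + 1 / 1 * (0ℚ * b + (1ℚ * a + 0ℚ)) + 0ℚ * z ≡ a + 0ℚ * w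
    lemma = solve-∀ ℚ-ring

  ¼ : ℚ
  ¼ = + 1 / 4

  ¼^ : ℕ → ℚ
  ¼^ zero    = 1ℚ
  ¼^ (suc n) = ¼ * ¼^ n

  eval-factor : ∀ k x → eval (factor k) (ι x) ≡ ι (factorℤ k x) * ¼
  eval-factor k x = begin
    - cst k + y * (0ℚ + y * (1ℚ + y * 0ℚ))
      ≡⟨ cong (λ z → - z + y * (0ℚ + y * (1ℚ + y * 0ℚ))) (/-as-ι* c 3) ⟩
    - (ι c * ¼) + y * (0ℚ + y * (1ℚ + y * 0ℚ))   ≡⟨ lemma (ι (+ 4)) y (ι c) ¼ 4¼≡1 ⟩
    (ι (+ 4) * (y * y) + - ι c) * ¼             ≡⟨ cong (_* ¼) (sym ι-factorℤ) ⟩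
    ι (factorℤ k x) * ¼                          ∎
    where
    y = ι x
    c = cstℤ k
    4¼≡1 : ι (+ 4) * ¼ ≡ 1ℚ
    4¼≡1 = refl
    lemma : ∀ f y c q → f * q ≡ 1ℚ →
            - (c * q) + y * (0ℚ + y * (1ℚ + y * 0ℚ)) ≡ (f * (y * y) + - c) * q
    lemma f y c q fq≡1 = begin
      - (c * q) + y * (0ℚ + y * (1ℚ + y * 0ℚ)) ≡⟨ expand y c q ⟩
      1ℚ * (y * y) - c * q                     ≡⟨ cong (λ z → z * (y * y) - c * q) (sym fq≡1) ⟩
      f * q * (y * y) - c * q                  ≡⟨ factorise f y c q ⟩
      (f * (y * y) + - c) * q                  ∎
      where
      expand : ∀ y c q → - (c * q) + y * (0ℚ + y * (1ℚ + y * 0ℚ)) ≡ 1ℚ * (y * y) - c * q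
      expand = solve-∀ ℚ-ring
      factorise : ∀ f y c q → f * q * (y * y) - c * q ≡ (f * (y * y) + - c) * q
      factorise = solve-∀ ℚ-ring
    ι-factorℤ : ι (factorℤ k x) ≡ ι (+ 4) * (y * y) + - ι c
    ι-factorℤ = trans (ι-+ (+ 4 ℤ.* (x ℤ.* x)) (ℤ.- c))
      (cong₂ _+_ (trans (ι-* (+ 4) (x ℤ.* x)) (cong (ι (+ 4) *_) (ι-* x x))) (ι-neg c))

  eval-prodFactors : ∀ n x → eval (prodFactors n) (ι x) ≡ ι (prodFactorsℤ n x) * ¼^ n
  eval-prodFactors zero    x = lemma (ι x)
    where
    lemma : ∀ y → 1ℚ + y * 0ℚ ≡ 1ℚ * 1ℚ
    lemma = solve-∀ ℚ-ring
  eval-prodFactors (suc n) x = begin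
    eval (prodFactors n *ₚ factor (suc n)) (ι x)
      ≡⟨ eval-*ₚ (prodFactors n) (factor (suc n)) (ι x) ⟩
    eval (prodFactors n) (ι x) * eval (factor (suc n)) (ι x)
      ≡⟨ cong₂ _*_ (eval-prodFactors n x) (eval-factor (suc n) x) ⟩
    ι (prodFactorsℤ n x) * ¼^ n * (ι (factorℤ (suc n) x) * ¼)
      ≡⟨ lemma (ι (prodFactorsℤ n x)) (¼^ n) (ι (factorℤ (suc n) x)) ¼ ⟩
    ι (prodFactorsℤ n x) * ι (factorℤ (suc n) x) * (¼ * ¼^ n)
      ≡⟨ cong (_* ¼^ (suc n)) (ι-* (prodFactorsℤ n x) (factorℤ (suc n) x)) ⟨
    ι (prodFactorsℤ (suc n) x) * ¼^ (suc n) ∎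
    where
    lemma : ∀ e u f q → e * u * (f * q) ≡ e * f * (q * u)
    lemma = solve-∀ ℚ-ring

  eval-Pn : ∀ n x → eval (Pn n) (ι x) ≡ ι (Pnℤ n x) * ¼^ n
  eval-Pn n x = begin
    eval ((0ℚ ∷ 1ℚ ∷ []) *ₚ prodFactors n) (ι x)
      ≡⟨ eval-*ₚ (0ℚ ∷ 1ℚ ∷ []) (prodFactors n) (ι x) ⟩
    (0ℚ + ι x * (1ℚ + ι x * 0ℚ)) * eval (prodFactors n) (ι x)
      ≡⟨ cong₂ _*_ (lemma (ι x)) (eval-prodFactors n x) ⟩
    ι x * (ι (prodFactorsℤ n x) * ¼^ n)
      ≡⟨ *-assoc (ι x) _ _ ⟨
    ι x * ι (prodFactorsℤ n x) * ¼^ n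
      ≡⟨ cong (_* ¼^ n) (ι-* x (prodFactorsℤ n x)) ⟨
    ι (Pnℤ n x) * ¼^ n ∎
    where
    lemma : ∀ y → 0ℚ + y * (1ℚ + y * 0ℚ) ≡ y
    lemma = solve-∀ ℚ-ring

  eval-deriv-Pn-0 : ∀ n → eval (deriv (Pn n)) 0ℚ ≡ ι (Pnℤ′ n 0ℤ) * ¼^ n
  eval-deriv-Pn-0 n = begin
    eval (deriv (Pn n)) 0ℚ                   ≡⟨ eval-deriv-x*ₚ-0 (prodFactors n) ⟩
    eval (prodFactors n) (ι 0ℤ)              ≡⟨ eval-prodFactors n 0ℤ ⟩
    ι (prodFactorsℤ n 0ℤ) * ¼^ n
      ≡⟨ cong (λ e → ι e * ¼^ n) (lemma (prodFactorsℤ n 0ℤ) (prodFactorsℤ′ n 0ℤ)) ⟩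
    ι (Pnℤ′ n 0ℤ) * ¼^ n                     ∎
    where
    lemma : ∀ e e′ → e ≡ 1ℤ ℤ.* e ℤ.+ 0ℤ ℤ.* e′
    lemma = ℤ.solve-∀

  sumBelow-ι : ∀ m {f g u} → (∀ x → f x ≡ ι (g (+ x)) * u) → sumBelow m f ≡ ι (sumBelowℤ m g) * u
  sumBelow-ι zero    {u = u} f≗ = sym (*-zeroˡ u)
  sumBelow-ι (suc m) {f} {g} {u} f≗ = begin
    sumBelow m f + f m                              ≡⟨ cong₂ _+_ (sumBelow-ι m f≗) (f≗ m) ⟩
    ι (sumBelowℤ m g) * u + ι (g (+ m)) * u         ≡⟨ *-distribʳ-+ u (ι (sumBelowℤ m g)) (ι (g (+ m))) ⟨
    (ι (sumBelowℤ m g) + ι (g (+ m))) * u           ≡⟨ cong (_* u) (ι-+ (sumBelowℤ m g) (g (+ m))) ⟨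
    ι (sumBelowℤ (suc m) g) * u                     ∎

  -- suc (denom n) = 2 · 4ⁿ
  denom : ℕ → ℕ
  denom zero    = 1
  denom (suc n) = 3 ℕ.+ denom n ℕ.* 4

  1/suc-denom : ∀ n → + 1 / suc (denom n) ≡ ½ * ¼^ n
  1/suc-denom zero    = sym (*-identityʳ ½)
  1/suc-denom (suc n) = begin
    + 1 / (suc (denom n) ℕ.* 4)       ≡⟨ 1/-* (denom n) 3 ⟩
    (+ 1 / suc (denom n)) * ¼         ≡⟨ cong (_* ¼) (1/suc-denom n) ⟩
    ½ * ¼^ n * ¼                      ≡⟨ lemma ½ (¼^ n) ¼ ⟩
    ½ * (¼ * ¼^ n)                    ∎
    where
    lemma : ∀ h u q → h * u * q ≡ h * (q * u)
    lemma = solve-∀ ℚ-ring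

  p∤suc-denom : ∀ {p} → Prime p → p ≢ 2 → ∀ n → ¬ p ℕ.∣ suc (denom n)
  p∤suc-denom {p} pp p≢2 = go
    where
    p∤2 : ¬ p ℕ.∣ 2
    p∤2 p∣2 = p≢2 (ℕ.≤-antisym (ℕ.∣⇒≤ p∣2) (ℕ.nonTrivial⇒n>1 p {{prime⇒nonTrivial pp}}))
    go : ∀ n → ¬ p ℕ.∣ suc (denom n)
    go zero = p∤2
    go (suc n) p∣ with euclidsLemma (suc (denom n)) 4 pp p∣
    ... | inj₁ p∣suc-denom = go n p∣suc-denom
    ... | inj₂ p∣4 = [ p∤2 , p∤2 ]′ (euclidsLemma 2 2 pp p∣4)

  valAtLeast-/ : ∀ {p k q a d} → q ≡ a / suc d → ¬ p ℕ.∣ suc d → + (p ℕ.^ k) ∣ a → ValAtLeast p k q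
  valAtLeast-/ {p} {k} {q} {d = d} refl p∤ (divides c refl) = c , d , p∤ , (begin
    (c ℤ.* + (p ℕ.^ k)) / suc d                ≡⟨ /-as-ι* (c ℤ.* + (p ℕ.^ k)) d ⟩
    ι (c ℤ.* + (p ℕ.^ k)) * (+ 1 / suc d)      ≡⟨ cong (_* (+ 1 / suc d)) (ι-* c (+ (p ℕ.^ k))) ⟩
    ι c * ι (+ (p ℕ.^ k)) * (+ 1 / suc d)      ≡⟨ lemma (ι c) (ι (+ (p ℕ.^ k))) (+ 1 / suc d) ⟩
    ι c * (+ 1 / suc d) * ι (+ (p ℕ.^ k))      ≡⟨ cong (_* ι (+ (p ℕ.^ k))) (/-as-ι* c d) ⟨
    (c / suc d) * ι (+ (p ℕ.^ k))              ∎)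
    where
    lemma : ∀ x y z → x * y * z ≡ x * z * y
    lemma = solve-∀ ℚ-ring

  halving-identity : ∀ s g m w K → m * w ≡ 1ℚ → s + s + m * g ≡ K * m → s * w - -½ * g ≡ K * ½
  halving-identity s g m w K mw≡1 sum≡ = begin
    s * w - -½ * g                      ≡⟨ unit s w g ½ ⟩
    s * w * 1ℚ + ½ * g * 1ℚ             ≡⟨ cong₂ (λ a b → s * w * a + ½ * g * b) ½+½≡1 mw≡1 ⟨
    s * w * (½ + ½) + ½ * g * (m * w)   ≡⟨ collect s w g ½ m ⟩
    ½ * w * (s + s + m * g)             ≡⟨ cong (½ * w *_) sum≡ ⟩
    ½ * w * (K * m)                     ≡⟨ rearrange ½ w K m ⟩
    K * ½ * (m * w)                     ≡⟨ cong (K * ½ *_) mw≡1 ⟩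
    K * ½ * 1ℚ                          ≡⟨ *-identityʳ (K * ½) ⟩
    K * ½                               ∎
    where
    ½+½≡1 : ½ + ½ ≡ 1ℚ
    ½+½≡1 = refl
    unit : ∀ s w g h → s * w - (- h) * g ≡ s * w * 1ℚ + h * g * 1ℚ
    unit = solve-∀ ℚ-ring
    collect : ∀ s w g h m → s * w * (h + h) + h * g * (m * w) ≡ h * w * (s + s + m * g)
    collect = solve-∀ ℚ-ring
    rearrange : ∀ h w K m → h * w * (K * m) ≡ K * h * (m * w)
    rearrange = solve-∀ ℚ-ring

  riemann-Pn-error : ∀ n p .{{_ : ℕ.NonZero p}} N K → let m = p ℕ.^ N in
    sumBelowℤ m (Pnℤ n) ℤ.+ sumBelowℤ m (Pnℤ n) ℤ.+ + m ℤ.* Pnℤ′ n 0ℤ ≡ K ℤ.* + m →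
    riemann p (λ x → eval (Pn n) (+ x / 1)) N - -½ * eval (deriv (Pn n)) 0ℚ ≡ K / suc (denom n)
  riemann-Pn-error n p N K sum≡ = begin
    riemann p (λ x → eval (Pn n) (+ x / 1)) N - -½ * eval (deriv (Pn n)) 0ℚ
      ≡⟨⟩
    sumBelow m (λ x → eval (Pn n) (+ x / 1)) * (+ 1 / m) - -½ * eval (deriv (Pn n)) 0ℚ
      ≡⟨ cong₂ (λ s g → s * (+ 1 / m) - -½ * g) (sumBelow-ι m (λ x → eval-Pn n (+ x))) (eval-deriv-Pn-0 n) ⟩
    ι S * u * (+ 1 / m) - -½ * (ι g₀ * u)
      ≡⟨ halving-identity (ι S * u) (ι g₀ * u) (ι (+ m)) (+ 1 / m) (ι K * u) (ι-*-1/ m) scaled ⟩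
    ι K * u * ½
      ≡⟨ *-assoc (ι K) u ½ ⟩
    ι K * (u * ½)
      ≡⟨ cong (ι K *_) (trans (*-comm u ½) (sym (1/suc-denom n))) ⟩
    ι K * (+ 1 / suc (denom n))
      ≡⟨ /-as-ι* K (denom n) ⟨
    K / suc (denom n) ∎
    where
    m = p ℕ.^ N
    instance
      _ = ℕ.m^n≢0 p N
    S = sumBelowℤ m (Pnℤ n)
    g₀ = Pnℤ′ n 0ℤ
    u = ¼^ n
    scaled : ι S * u + ι S * u + ι (+ m) * (ι g₀ * u) ≡ ι K * u * ι (+ m)
    scaled = begin
      ι S * u + ι S * u + ι (+ m) * (ι g₀ * u)  ≡⟨ factor-u (ι S) (ι (+ m)) (ι g₀) u ⟩
      (ι S + ι S + ι (+ m) * ι g₀) * u          ≡⟨ cong (_* u) ι-sum ⟨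
      ι (S ℤ.+ S ℤ.+ + m ℤ.* g₀) * u            ≡⟨ cong (λ z → ι z * u) sum≡ ⟩
      ι (K ℤ.* + m) * u                         ≡⟨ cong (_* u) (ι-* K (+ m)) ⟩
      ι K * ι (+ m) * u                         ≡⟨ swap (ι K) (ι (+ m)) u ⟩
      ι K * u * ι (+ m)                         ∎
      where
      ι-sum : ι (S ℤ.+ S ℤ.+ + m ℤ.* g₀) ≡ ι S + ι S + ι (+ m) * ι g₀
      ι-sum = trans (ι-+ (S ℤ.+ S) (+ m ℤ.* g₀)) (cong₂ _+_ (ι-+ S S) (ι-* (+ m) g₀))
      factor-u : ∀ s m g u → s * u + s * u + m * (g * u) ≡ (s + s + m * g) * u
      factor-u = solve-∀ ℚ-ring
      swap : ∀ x y z → x * y * z ≡ x * z * y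
      swap = solve-∀ ℚ-ring

open OverIntegers
open OverRationals
open import Data.Nat as ℕ using (ℕ; suc; s≤s; _^_)
import Data.Nat.Properties as ℕ
import Data.Nat.Divisibility as ℕ
open import Data.Nat.Primality using (Prime; prime⇒nonZero)
open import Data.Integer as ℤ using (+_)
open import Data.Integer.Divisibility.Signed using (∣-trans; ∣ᵤ⇒∣)
open import Data.Rational using (_/_; _*_; _-_; -_; -½; 0ℚ)
open import Relation.Binary.PropositionalEquality
open import Data.Product using (_,_)

^-monoʳ-∣ : ∀ p {k N} → k ℕ.≤ N → p ^ k ℕ.∣ p ^ N
^-monoʳ-∣ p {k} {N} k≤N = ℕ.divides (p ^ (N ℕ.∸ k)) (begin
  p ^ N                          ≡⟨ cong (p ^_) (ℕ.m+[n∸m]≡n k≤N) ⟨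
  p ^ (k ℕ.+ (N ℕ.∸ k))          ≡⟨ ℕ.^-distribˡ-+-* p k (N ℕ.∸ k) ⟩
  p ^ k ℕ.* p ^ (N ℕ.∸ k)        ≡⟨ ℕ.*-comm (p ^ k) (p ^ (N ℕ.∸ k)) ⟩
  p ^ (N ℕ.∸ k) ℕ.* p ^ k        ∎)
  where open ≡-Reasoning

mainTheorem4 : (p : ℕ) → (pp : Prime p) → p ≢ 2 → (n : ℕ) →
    VolkenbornIntegralIs p pp (λ x → eval (Pn n) ((+ x) / 1))
    ((- ((+ 1) / 2)) * eval (deriv (Pn n)) 0ℚ)
mainTheorem4 p pp p≢2 n k = suc k , small-error
  where
  instance
    _ = prime⇒nonZero pp
  small-error : ∀ N → suc k ℕ.≤ N →
    ValAtLeast p k (riemann p (λ x → eval (Pn n) ((+ x) / 1)) N - -½ * eval (deriv (Pn n)) 0ℚ)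
  small-error (suc N) (s≤s k≤N) =
    let K , sum≡ , p^N∣K =
          sumBelowℤ-odd-^ (Pnℤ-odd n) (hasDerivative-Pnℤ n) (preservesCongruence-Pnℤ′ n) p N
    -- ValAtLeast unfolds to a Σ-type, from which p and k cannot be inferred.
    in valAtLeast-/ {p} {k} (riemann-Pn-error n p (suc N) K sum≡) (p∤suc-denom pp p≢2 n)
                    (∣-trans (∣ᵤ⇒∣ (^-monoʳ-∣ p k≤N)) p^N∣K)
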